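{- Let $\mathcal{H}$ be a $3$-partite $3$-graph with $\nu(\mathcal{H})=1$ and $\tau(\mathcal{H})=2$. Then $\mathcal{H}$ is a home-base hypergraph.
   Context: A $3$-partite $3$-graph has vertex classes $V_1,V_2,V_3$ and a multiset of edges each with exactly one vertex per class; $\nu,\tau$: matching and vertex cover numbers; $\mathcal{H}|_U$: edges contained in $U$. Truncated Fano plane: the $3$-graph on $\{a,b,c,x,y,z\}$ with edges $abc,ayz,xbz,xyc$; truncated multi-Fano plane: obtained by adding parallel copies of edges. An FR-partition is a triple $(\mathcal{F},\mathcal{R},W)$ with (1) $\mathcal{F}\cup\mathcal{R}\cup\{W\}$ a partition of $V(\mathcal{H})$; (2) each $\mathcal{H}|_F$ ($F\in\mathcal{F}$) isomorphic to a truncated multi-Fano plane; (3) each $R\in\mathcal{R}$ a $3$-set with one vertex per class; (4) $|\mathcal{F}\cup\mathcal{R}|=\nu(\mathcal{H})$. A home-base partition is an FR-partition such that for each $i$ the bipartite graph with classes $\mathcal{R}$ and $W\cap V_i$ ($R\sim w$ iff some edge contains $w$ and two vertices of $R$) has a matching saturating $\mathcal{R}$, and every edge lies in some $\mathcal{H}|_F$ ($F\in\mathcal{F}$) or contains two vertices of some $R\in\mathcal{R}$. A home-base hypergraph is one with a home-base partition. -}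

module Defs where

open import Data.Nat using (ℕ; _≤_)
open import Data.Fin using (Fin; zero; suc)
open import Data.Product using (Σ; ∃; _×_; _,_)
open import Data.Sum using (_⊎_; inj₁; inj₂)
open import Data.List using (List; []; _∷_; length; concatMap; _++_; lookup)
open import Data.List.Membership.Propositional using (_∈_; _∉_)
open import Data.List.Relation.Unary.All using (All)
open import Data.List.Relation.Unary.AllPairs using (AllPairs)
open import Data.List.Relation.Unary.Unique.Propositional using (Unique)
open import Relation.Binary.PropositionalEquality using (_≡_; _≢_)
open import Relation.Nullary using (¬_)
open import Data.Unit using (⊤)
open import Data.Empty using (⊥)
open import Function.Definitions using (Injective)

-- An edge has exactly one vertex in each class; the hypergraph is a
-- list of edges (a multiset: repetitions = parallel edges).

Edge : ℕ → ℕ → ℕ → Set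
Edge n₁ n₂ n₃ = Fin n₁ × Fin n₂ × Fin n₃

Vtx : ℕ → ℕ → ℕ → Set
Vtx n₁ n₂ n₃ = Fin n₁ ⊎ Fin n₂ ⊎ Fin n₃

module _ {n₁ n₂ n₃ : ℕ} where

  V = Vtx n₁ n₂ n₃
  E3 = Edge n₁ n₂ n₃

  -- membership of a vertex in class V_i (i = 0,1,2 stand for classes 1,2,3)
  InClass : Fin 3 → V → Set
  InClass zero          (inj₁ _)        = ⊤
  InClass zero          (inj₂ _)        = ⊥
  InClass (suc zero)    (inj₂ (inj₁ _)) = ⊤
  InClass (suc zero)    _               = ⊥
  InClass (suc (suc _)) (inj₂ (inj₂ _)) = ⊤
  InClass (suc (suc _)) _               = ⊥

  verts : E3 → List V
  verts (i , j , k) = inj₁ i ∷ inj₂ (inj₁ j) ∷ inj₂ (inj₂ k) ∷ []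

  Disjoint : E3 → E3 → Set
  Disjoint e f = ∀ v → v ∈ verts e → v ∉ verts f

  IsMatching : List E3 → List E3 → Set
  IsMatching H M = All (_∈ H) M × AllPairs Disjoint M

  MatchingNumber : List E3 → ℕ → Set
  MatchingNumber H k =
    (Σ (List E3) λ M → IsMatching H M × length M ≡ k) ×
    (∀ M → IsMatching H M → length M ≤ k)

  IsCover : List E3 → List V → Set
  IsCover H C = ∀ e → e ∈ H → Σ V λ v → v ∈ C × v ∈ verts e

  -- τ(H) = k  (covers given as lists; repetitions only increase length)
  CoverNumber : List E3 → ℕ → Set
  CoverNumber H k =
    (Σ (List V) λ C → IsCover H C × length C ≡ k) ×
    (∀ C → IsCover H C → k ≤ length C)

  -- a candidate truncated-Fano block: vertices a,x ∈ V₁, b,y ∈ V₂, c,z ∈ V₃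
  -- (the Fano edges abc, ayz, xbz, xyc force this class assignment)
  record Block : Set where
    constructor block
    field
      a x : Fin n₁
      b y : Fin n₂
      c z : Fin n₃

  blockVerts : Block → List V
  blockVerts (block a x b y c z) =
    inj₁ a ∷ inj₁ x ∷ inj₂ (inj₁ b) ∷ inj₂ (inj₁ y) ∷ inj₂ (inj₂ c) ∷ inj₂ (inj₂ z) ∷ []

  EdgeIn : List V → E3 → Set
  EdgeIn U e = All (_∈ U) (verts e)

  IsTruncMultiFano : List E3 → Block → Set
  IsTruncMultiFano H F@(block a x b y c z) =
    (∀ e → e ∈ H → EdgeIn (blockVerts F) e →
       e ≡ (a , b , c) ⊎ e ≡ (a , y , z) ⊎ e ≡ (x , b , z) ⊎ e ≡ (x , y , c)) ×
    (a , b , c) ∈ H × (a , y , z) ∈ H × (x , b , z) ∈ H × (x , y , c) ∈ H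

  -- an R-part: a 3-set with one vertex in each class
  R3 = E3

  -- all vertices covered by the parts in 𝓕 ∪ 𝓡 (with multiplicity)
  partVerts : List Block → List R3 → List V
  partVerts Fs Rs = concatMap blockVerts Fs ++ concatMap verts Rs

  InW : List Block → List R3 → V → Set
  InW Fs Rs v = v ∉ partVerts Fs Rs

  -- (𝓕, 𝓡, W) is an FR-partition: the parts of 𝓕 ∪ 𝓡 are pairwise
  -- disjoint 6-sets / 3-sets (W is the complement, so 𝓕 ∪ 𝓡 ∪ {W}
  -- partitions V(H)), each H|_F is a truncated multi-Fano plane,
  -- and |𝓕 ∪ 𝓡| = ν(H).
  IsFRPartition : List E3 → List Block → List R3 → Set
  IsFRPartition H Fs Rs =
    Unique (partVerts Fs Rs) ×
    All (IsTruncMultiFano H) Fs ×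
    MatchingNumber H (length Fs Data.Nat.+ length Rs)
    where import Data.Nat

  ContainsTwo : R3 → E3 → Set
  ContainsTwo R e = Σ V λ u → Σ V λ v →
    u ≢ v × u ∈ verts R × v ∈ verts R × u ∈ verts e × v ∈ verts e

  Adj : List E3 → R3 → V → Set
  Adj H R w = Σ E3 λ e → e ∈ H × w ∈ verts e × ContainsTwo R e

  SaturatingMatching : List E3 → List Block → List R3 → Fin 3 → Set
  SaturatingMatching H Fs Rs i =
    Σ (Fin (length Rs) → V) λ f →
      Injective _≡_ _≡_ f ×
      (∀ r → InClass i (f r) × InW Fs Rs (f r) × Adj H (lookup Rs r) (f r))

  IsHomeBasePartition : List E3 → List Block → List R3 → Set
  IsHomeBasePartition H Fs Rs =
    IsFRPartition H Fs Rs ×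
    (∀ i → SaturatingMatching H Fs Rs i) ×
    (∀ e → e ∈ H →
      (Σ Block λ F → F ∈ Fs × EdgeIn (blockVerts F) e) ⊎
      (Σ R3 λ R → R ∈ Rs × ContainsTwo R e))

  IsHomeBase : List E3 → Set
  IsHomeBase H = Σ (List Block) λ Fs → Σ (List R3) λ Rs → IsHomeBasePartition H Fs Rs

-- Since ν(H) = 1 any two edges meet, and since τ(H) = 2 every vertex misses some edge.
-- Fix an edge e.  If every edge shares two vertices with e, the 3-set e is a home base.
-- Otherwise some edge f meets e in a single vertex, say e = abc and f = ayz.  An edge
-- avoiding a must meet both, so it is xbz or xyc, and after swapping e and f it is xbz.
-- If xyc is an edge as well, these four edges force H to be the truncated multi-Fano
-- plane on a, b, c, x, y, z; if not, every edge contains two of a, b, z.  In the second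
-- case R = abz is a home base: class i is saturated by the i-th vertex of any edge
-- missing the i-th vertex of R.
module Submission where

open import Defs
open import Data.Nat using (ℕ)
open import Data.Nat.Properties using (<-irrefl)
open import Data.Fin using (Fin; zero; suc)
open import Data.Fin.Properties using (_≟_)
open import Data.Product using (∃; _×_; _,_; proj₁; proj₂; map; map₂)
import Data.Product.Properties as Product
open import Data.Sum using (_⊎_; inj₁; inj₂; [_,_]′)
import Data.Sum.Properties as Sum
open import Data.Sum.Properties using (inj₁-injective; inj₂-injective)
open import Data.List using (List; []; _∷_)
open import Data.List.Relation.Unary.Any using (here; there)
open import Data.List.Relation.Unary.All using ([]; _∷_)
open import Data.List.Relation.Unary.AllPairs using ([]; _∷_)
open import Data.List.Relation.Unary.Unique.Propositional using (Unique)
open import Data.List.Membership.Propositional using (_∈_; _∉_)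
import Data.List.Membership.DecPropositional as DecMembership
open import Data.Empty using (⊥-elim)
open import Data.Unit using (tt)
open import Function using (_∘_; id)
open import Level using (0ℓ)
open import Relation.Unary using (Pred; Decidable)
open import Relation.Nullary using (Dec; yes; no; ¬_)
open import Relation.Nullary.Decidable using (toSum; _⊎-dec_)
open import Relation.Binary.Definitions using (DecidableEquality)
open import Relation.Binary.PropositionalEquality using (_≡_; _≢_; refl; sym; cong; subst)

all-or-some : ∀ {A : Set} {Q R : Pred A 0ℓ} (xs : List A) →
  (∀ {x} → x ∈ xs → Q x ⊎ R x) →
  (∀ {x} → x ∈ xs → Q x) ⊎ (∃ λ x → x ∈ xs × R x)
all-or-some [] _ = inj₁ λ ()
all-or-some (x ∷ xs) q-or-r with q-or-r (here refl) | all-or-some xs (q-or-r ∘ there)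
... | inj₂ r | _                   = inj₂ (x , here refl , r)
... | inj₁ _ | inj₂ (y , y∈ , r)   = inj₂ (y , there y∈ , r)
... | inj₁ q | inj₁ qs             = inj₁ λ { (here refl) → q ; (there y∈) → qs y∈ }

module _ {A B C : Set} where

  ShareOne ShareTwo ShareOnlyFirst : A × B × C → A × B × C → Set
  ShareOne       (a , b , c) (a′ , b′ , c′) = a ≡ a′ ⊎ b ≡ b′ ⊎ c ≡ c′
  ShareTwo       (a , b , c) (a′ , b′ , c′) = a ≡ a′ × b ≡ b′ ⊎ a ≡ a′ × c ≡ c′ ⊎ b ≡ b′ × c ≡ c′
  ShareOnlyFirst (a , b , c) (a′ , b′ , c′) = a ≡ a′ × b ≢ b′ × c ≢ c′

  Intersecting : Pred (A × B × C) 0ℓ → Set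
  Intersecting P = ∀ {e f} → P e → P f → ShareOne e f

  NoCoveringVertex : Pred (A × B × C) 0ℓ → Set
  NoCoveringVertex P =
    (∀ a → ∃ λ g → P g × proj₁ g ≢ a) ×
    (∀ b → ∃ λ g → P g × proj₁ (proj₂ g) ≢ b) ×
    (∀ c → ∃ λ g → P g × proj₂ (proj₂ g) ≢ c)

  AllShareTwo : Pred (A × B × C) 0ℓ → A × B × C → Set
  AllShareTwo P R = ∀ {h} → P h → ShareTwo R h

  record TruncatedFano (P : Pred (A × B × C) 0ℓ) : Set where
    field
      a x : A
      b y : B
      c z : C
      a≢x : a ≢ x
      b≢y : b ≢ y
      c≢z : c ≢ z
      abc∈ : P (a , b , c)
      ayz∈ : P (a , y , z)
      xbz∈ : P (x , b , z)
      xyc∈ : P (x , y , c)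
      only : ∀ {h} → P h →
        h ≡ (a , b , c) ⊎ h ≡ (a , y , z) ⊎ h ≡ (x , b , z) ⊎ h ≡ (x , y , c)

  Classification : Pred (A × B × C) 0ℓ → Set
  Classification P = (∃ λ R → AllShareTwo P R) ⊎ TruncatedFano P

  -- P ∘ unshift is P with its vertex classes cyclically renamed; it is what lets the
  -- argument assume that a shared vertex lies in the first class.
  shift : A × B × C → B × C × A
  shift (a , b , c) = b , c , a

  unshift : B × C × A → A × B × C
  unshift (b , c , a) = a , b , c

module _ {A B C : Set} {P : Pred (A × B × C) 0ℓ} (intersecting : Intersecting P) where

  truncatedFano-only : ∀ {a x b y c z h} → a ≢ x → b ≢ y → c ≢ z →
    P (a , b , c) → P (a , y , z) → P (x , b , z) → P (x , y , c) → P h →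
    h ≡ (a , b , c) ⊎ h ≡ (a , y , z) ⊎ h ≡ (x , b , z) ⊎ h ≡ (x , y , c)
  truncatedFano-only a≢x b≢y c≢z abc∈ ayz∈ xbz∈ xyc∈ h∈ with intersecting h∈ abc∈
  ... | inj₁ refl with intersecting h∈ xbz∈ | intersecting h∈ xyc∈
  ...   | inj₁ refl        | _                = ⊥-elim (a≢x refl)
  ...   | _                | inj₁ refl        = ⊥-elim (a≢x refl)
  ...   | inj₂ (inj₁ refl) | inj₂ (inj₁ refl) = ⊥-elim (b≢y refl)
  ...   | inj₂ (inj₁ refl) | inj₂ (inj₂ refl) = inj₁ refl
  ...   | inj₂ (inj₂ refl) | inj₂ (inj₁ refl) = inj₂ (inj₁ refl)
  ...   | inj₂ (inj₂ refl) | inj₂ (inj₂ refl) = ⊥-elim (c≢z refl)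
  truncatedFano-only a≢x b≢y c≢z abc∈ ayz∈ xbz∈ xyc∈ h∈ | inj₂ (inj₁ refl)
    with intersecting h∈ ayz∈ | intersecting h∈ xyc∈
  ...   | inj₂ (inj₁ refl) | _                = ⊥-elim (b≢y refl)
  ...   | _                | inj₂ (inj₁ refl) = ⊥-elim (b≢y refl)
  ...   | inj₁ refl        | inj₁ refl        = ⊥-elim (a≢x refl)
  ...   | inj₁ refl        | inj₂ (inj₂ refl) = inj₁ refl
  ...   | inj₂ (inj₂ refl) | inj₁ refl        = inj₂ (inj₂ (inj₁ refl))
  ...   | inj₂ (inj₂ refl) | inj₂ (inj₂ refl) = ⊥-elim (c≢z refl)
  truncatedFano-only a≢x b≢y c≢z abc∈ ayz∈ xbz∈ xyc∈ h∈ | inj₂ (inj₂ refl)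
    with intersecting h∈ ayz∈ | intersecting h∈ xbz∈
  ...   | inj₂ (inj₂ refl) | _                = ⊥-elim (c≢z refl)
  ...   | _                | inj₂ (inj₂ refl) = ⊥-elim (c≢z refl)
  ...   | inj₁ refl        | inj₁ refl        = ⊥-elim (a≢x refl)
  ...   | inj₁ refl        | inj₂ (inj₁ refl) = inj₁ refl
  ...   | inj₂ (inj₁ refl) | inj₁ refl        = inj₂ (inj₂ (inj₂ refl))
  ...   | inj₂ (inj₁ refl) | inj₂ (inj₁ refl) = ⊥-elim (b≢y refl)

  allShareTwo-abz : ∀ {a x b y c z} → a ≢ x → b ≢ y → c ≢ z →
    P (a , b , c) → P (a , y , z) → P (x , b , z) → ¬ P (x , y , c) → AllShareTwo P (a , b , z)
  allShareTwo-abz a≢x b≢y c≢z abc∈ ayz∈ xbz∈ xyc∉ h∈ with intersecting h∈ xbz∈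
  ... | inj₂ (inj₁ refl) with intersecting h∈ ayz∈
  ...   | inj₁ refl        = inj₁ (refl , refl)
  ...   | inj₂ (inj₁ refl) = ⊥-elim (b≢y refl)
  ...   | inj₂ (inj₂ refl) = inj₂ (inj₂ (refl , refl))
  allShareTwo-abz a≢x b≢y c≢z abc∈ ayz∈ xbz∈ xyc∉ h∈ | inj₂ (inj₂ refl) with intersecting h∈ abc∈
  ...   | inj₁ refl        = inj₂ (inj₁ (refl , refl))
  ...   | inj₂ (inj₁ refl) = inj₂ (inj₂ (refl , refl))
  ...   | inj₂ (inj₂ refl) = ⊥-elim (c≢z refl)
  allShareTwo-abz a≢x b≢y c≢z abc∈ ayz∈ xbz∈ xyc∉ h∈ | inj₁ refl
    with intersecting h∈ abc∈ | intersecting h∈ ayz∈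
  ...   | inj₁ refl        | _                = ⊥-elim (a≢x refl)
  ...   | _                | inj₁ refl        = ⊥-elim (a≢x refl)
  ...   | inj₂ (inj₁ refl) | inj₂ (inj₁ refl) = ⊥-elim (b≢y refl)
  ...   | inj₂ (inj₁ refl) | inj₂ (inj₂ refl) = inj₂ (inj₂ (refl , refl))
  ...   | inj₂ (inj₂ refl) | inj₂ (inj₁ refl) = ⊥-elim (xyc∉ h∈)
  ...   | inj₂ (inj₂ refl) | inj₂ (inj₂ refl) = ⊥-elim (c≢z refl)

  fano-or-allShareTwo : ∀ {a x b y c z} → a ≢ x → b ≢ y → c ≢ z →
    P (a , b , c) → P (a , y , z) → P (x , b , z) → Dec (P (x , y , c)) → Classification P
  fano-or-allShareTwo a≢x b≢y c≢z abc∈ ayz∈ xbz∈ (yes xyc∈) = inj₂ record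
    { a≢x = a≢x ; b≢y = b≢y ; c≢z = c≢z
    ; abc∈ = abc∈ ; ayz∈ = ayz∈ ; xbz∈ = xbz∈ ; xyc∈ = xyc∈
    ; only = truncatedFano-only a≢x b≢y c≢z abc∈ ayz∈ xbz∈ xyc∈
    }
  fano-or-allShareTwo a≢x b≢y c≢z abc∈ ayz∈ xbz∈ (no xyc∉) =
    inj₁ (_ , allShareTwo-abz a≢x b≢y c≢z abc∈ ayz∈ xbz∈ xyc∉)

  classify-shareOnlyFirst : (∀ a → ∃ λ g → P g × proj₁ g ≢ a) → Decidable P →
    ∀ {e f} → P e → P f → ShareOnlyFirst e f → Classification P
  classify-shareOnlyFirst avoid₁ P? {a , b , c} {_ , y , z} e∈ f∈ (refl , b≢y , c≢z) with avoid₁ a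
  ... | (x , _ , _) , g∈ , x≢a with intersecting g∈ e∈ | intersecting g∈ f∈
  ...   | inj₁ refl        | _                = ⊥-elim (x≢a refl)
  ...   | _                | inj₁ refl        = ⊥-elim (x≢a refl)
  ...   | inj₂ (inj₁ refl) | inj₂ (inj₁ refl) = ⊥-elim (b≢y refl)
  ...   | inj₂ (inj₁ refl) | inj₂ (inj₂ refl) =
    fano-or-allShareTwo (x≢a ∘ sym) b≢y c≢z e∈ f∈ g∈ (P? (x , y , c))
  ...   | inj₂ (inj₂ refl) | inj₂ (inj₁ refl) =
    fano-or-allShareTwo (x≢a ∘ sym) (b≢y ∘ sym) (c≢z ∘ sym) f∈ e∈ g∈ (P? (x , b , z))
  ...   | inj₂ (inj₂ refl) | inj₂ (inj₂ refl) = ⊥-elim (c≢z refl)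

module _ {A B C : Set} {P : Pred (A × B × C) 0ℓ} where

  intersecting-unshift : Intersecting P → Intersecting (P ∘ unshift)
  intersecting-unshift intersecting e∈ f∈ with intersecting e∈ f∈
  ... | inj₁ p        = inj₂ (inj₂ p)
  ... | inj₂ (inj₁ p) = inj₁ p
  ... | inj₂ (inj₂ p) = inj₂ (inj₁ p)

  noCoveringVertex-unshift : NoCoveringVertex P → NoCoveringVertex (P ∘ unshift)
  noCoveringVertex-unshift (avoid₁ , avoid₂ , avoid₃) =
    map shift id ∘ avoid₂ ,
    map shift id ∘ avoid₃ ,
    map shift id ∘ avoid₁

  shareTwo-unshift : ∀ (R : B × C × A) (h : A × B × C) → ShareTwo R (shift h) → ShareTwo (unshift R) h
  shareTwo-unshift _ _ (inj₁ (p , q))        = inj₂ (inj₂ (p , q))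
  shareTwo-unshift _ _ (inj₂ (inj₁ (p , q))) = inj₁ (q , p)
  shareTwo-unshift _ _ (inj₂ (inj₂ (p , q))) = inj₂ (inj₁ (q , p))

  truncatedFano-unshift : TruncatedFano (P ∘ unshift) → TruncatedFano P
  truncatedFano-unshift F = record
    { a≢x = c≢z ; b≢y = a≢x ; c≢z = b≢y
    ; abc∈ = abc∈ ; ayz∈ = xyc∈ ; xbz∈ = ayz∈ ; xyc∈ = xbz∈
    ; only = λ {h} h∈ → relabel (only {shift h} h∈)
    }
    where
      open TruncatedFano F
      relabel : ∀ {h} → shift h ≡ (a , b , c) ⊎ shift h ≡ (a , y , z) ⊎ shift h ≡ (x , b , z) ⊎ shift h ≡ (x , y , c) →
        h ≡ (c , a , b) ⊎ h ≡ (c , x , y) ⊎ h ≡ (z , a , y) ⊎ h ≡ (z , x , b)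
      relabel (inj₁ p)               = inj₁ (cong unshift p)
      relabel (inj₂ (inj₁ p))        = inj₂ (inj₂ (inj₁ (cong unshift p)))
      relabel (inj₂ (inj₂ (inj₁ p))) = inj₂ (inj₂ (inj₂ (cong unshift p)))
      relabel (inj₂ (inj₂ (inj₂ p))) = inj₂ (inj₁ (cong unshift p))

  classification-unshift : Classification (P ∘ unshift) → Classification P
  classification-unshift (inj₁ (R , allShareTwo)) =
    inj₁ (unshift R , λ {h} h∈ → shareTwo-unshift R h (allShareTwo {shift h} h∈))
  classification-unshift (inj₂ F) = inj₂ (truncatedFano-unshift F)

module _ {A B C : Set} where

  ShareOnlyOne : A × B × C → A × B × C → Set
  ShareOnlyOne e f =
    ShareOnlyFirst e f ⊎ ShareOnlyFirst (shift e) (shift f) ⊎ ShareOnlyFirst (shift (shift e)) (shift (shift f))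

  shareTwo-or-shareOnlyOne : DecidableEquality A → DecidableEquality B → DecidableEquality C →
    ∀ e f → ShareOne e f → ShareTwo e f ⊎ ShareOnlyOne e f
  shareTwo-or-shareOnlyOne _≟A_ _≟B_ _≟C_ (a , b , c) (a′ , b′ , c′) share
    with a ≟A a′ | b ≟B b′ | c ≟C c′
  ... | yes p | yes q | _     = inj₁ (inj₁ (p , q))
  ... | yes p | no _  | yes r = inj₁ (inj₂ (inj₁ (p , r)))
  ... | no _  | yes q | yes r = inj₁ (inj₂ (inj₂ (q , r)))
  ... | yes p | no q  | no r  = inj₂ (inj₁ (p , q , r))
  ... | no p  | yes q | no r  = inj₂ (inj₂ (inj₁ (q , r , p)))
  ... | no p  | no q  | yes r = inj₂ (inj₂ (inj₂ (r , p , q)))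
  ... | no p  | no q  | no r  = ⊥-elim ([ p , [ q , r ]′ ]′ share)

  classify-shareOnlyOne : {P : Pred (A × B × C) 0ℓ} → Intersecting P → NoCoveringVertex P → Decidable P →
    ∀ {e f} → P e → P f → ShareOnlyOne e f → Classification P
  classify-shareOnlyOne intersecting noCover P? e∈ f∈ (inj₁ s) =
    classify-shareOnlyFirst intersecting (proj₁ noCover) P? e∈ f∈ s
  classify-shareOnlyOne intersecting noCover P? {e} {f} e∈ f∈ (inj₂ (inj₁ s)) =
    classification-unshift
      (classify-shareOnlyFirst (intersecting-unshift intersecting)
        (proj₁ (noCoveringVertex-unshift noCover)) (P? ∘ unshift) {shift e} {shift f} e∈ f∈ s)
  classify-shareOnlyOne intersecting noCover P? {e} {f} e∈ f∈ (inj₂ (inj₂ s)) =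
    classification-unshift (classification-unshift
      (classify-shareOnlyFirst (intersecting-unshift (intersecting-unshift intersecting))
        (proj₁ (noCoveringVertex-unshift (noCoveringVertex-unshift noCover))) (P? ∘ unshift ∘ unshift)
        {shift (shift e)} {shift (shift f)} e∈ f∈ s))

  classify : DecidableEquality A → DecidableEquality B → DecidableEquality C →
    (H : List (A × B × C)) → Intersecting (_∈ H) → NoCoveringVertex (_∈ H) →
    ∀ {e} → e ∈ H → Classification (_∈ H)
  classify _≟A_ _≟B_ _≟C_ H intersecting noCover {e} e∈
    with all-or-some H (λ {f} f∈ → shareTwo-or-shareOnlyOne _≟A_ _≟B_ _≟C_ e f (intersecting e∈ f∈))
  ... | inj₁ allShareTwo     = inj₁ (e , allShareTwo)
  ... | inj₂ (f , f∈ , only) = classify-shareOnlyOne intersecting noCover (_∈? H) e∈ f∈ only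
    where open DecMembership (Product.≡-dec _≟A_ (Product.≡-dec _≟B_ _≟C_))

module _ {n₁ n₂ n₃ : ℕ} where

  shared-vertex⇒shareOne : ∀ {v} {e f : Edge n₁ n₂ n₃} → v ∈ verts e → v ∈ verts f → ShareOne e f
  shared-vertex⇒shareOne (here refl)                 (here refl)                 = inj₁ refl
  shared-vertex⇒shareOne (here refl)                 (there (here ()))
  shared-vertex⇒shareOne (here refl)                 (there (there (here ())))
  shared-vertex⇒shareOne (there (here refl))         (here ())
  shared-vertex⇒shareOne (there (here refl))         (there (here refl))         = inj₂ (inj₁ refl)
  shared-vertex⇒shareOne (there (here refl))         (there (there (here ())))
  shared-vertex⇒shareOne (there (there (here refl))) (here ())
  shared-vertex⇒shareOne (there (there (here refl))) (there (here ()))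
  shared-vertex⇒shareOne (there (there (here refl))) (there (there (here refl))) = inj₂ (inj₂ refl)

  vertexAt : Fin 3 → Edge n₁ n₂ n₃ → Vtx n₁ n₂ n₃
  vertexAt zero          (a , _ , _) = inj₁ a
  vertexAt (suc zero)    (_ , b , _) = inj₂ (inj₁ b)
  vertexAt (suc (suc _)) (_ , _ , c) = inj₂ (inj₂ c)

  vertexAt-∈ : ∀ i e → vertexAt i e ∈ verts e
  vertexAt-∈ zero          _ = here refl
  vertexAt-∈ (suc zero)    _ = there (here refl)
  vertexAt-∈ (suc (suc _)) _ = there (there (here refl))

  vertexAt-inClass : ∀ i e → InClass i (vertexAt i e)
  vertexAt-inClass zero          _ = tt
  vertexAt-inClass (suc zero)    _ = tt
  vertexAt-inClass (suc (suc _)) _ = tt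

  vertexAt-∈⇒≡ : ∀ i {e f} → vertexAt i e ∈ verts f → vertexAt i e ≡ vertexAt i f
  vertexAt-∈⇒≡ zero          (here p)                   = p
  vertexAt-∈⇒≡ zero          (there (here ()))
  vertexAt-∈⇒≡ zero          (there (there (here ())))
  vertexAt-∈⇒≡ (suc zero)    (here ())
  vertexAt-∈⇒≡ (suc zero)    (there (here p))           = p
  vertexAt-∈⇒≡ (suc zero)    (there (there (here ())))
  vertexAt-∈⇒≡ (suc (suc _)) (here ())
  vertexAt-∈⇒≡ (suc (suc _)) (there (here ()))
  vertexAt-∈⇒≡ (suc (suc _)) (there (there (here p)))   = p

  shareTwo⇒containsTwo : ∀ {R e : Edge n₁ n₂ n₃} → ShareTwo R e → ContainsTwo R e
  shareTwo⇒containsTwo (inj₁ (refl , refl)) =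
    _ , _ , (λ ()) , here refl , there (here refl) , here refl , there (here refl)
  shareTwo⇒containsTwo (inj₂ (inj₁ (refl , refl))) =
    _ , _ , (λ ()) , here refl , there (there (here refl)) , here refl , there (there (here refl))
  shareTwo⇒containsTwo (inj₂ (inj₂ (refl , refl))) =
    _ , _ , (λ ()) , there (here refl) , there (there (here refl)) , there (here refl) , there (there (here refl))

module _ {n₁ n₂ n₃ : ℕ} {H : List (Edge n₁ n₂ n₃)} where

  open DecMembership (Sum.≡-dec (_≟_ {n₁}) (Sum.≡-dec (_≟_ {n₂}) (_≟_ {n₃}))) using (_∈?_)

  ν≡1⇒intersecting : MatchingNumber H 1 → Intersecting (_∈ H)
  ν≡1⇒intersecting (_ , maximal) {e₁ , e₂ , e₃} {f₁ , f₂ , f₃} e∈ f∈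
    with (e₁ ≟ f₁) ⊎-dec (e₂ ≟ f₂) ⊎-dec (e₃ ≟ f₃)
  ... | yes share = share
  ... | no ¬share = ⊥-elim (<-irrefl refl (maximal (_ ∷ _ ∷ []) ((e∈ ∷ f∈ ∷ []) , (disjoint ∷ []) ∷ [] ∷ [])))
    where
      disjoint : Disjoint (e₁ , e₂ , e₃) (f₁ , f₂ , f₃)
      disjoint _ v∈e v∈f = ¬share (shared-vertex⇒shareOne v∈e v∈f)

  ν≡1⇒nonempty : MatchingNumber H 1 → ∃ λ e → e ∈ H
  ν≡1⇒nonempty (([] , _ , ()) , _)
  ν≡1⇒nonempty ((_ ∷ [] , (e∈ ∷ [] , _) , _) , _) = _ , e∈
  ν≡1⇒nonempty ((_ ∷ _ ∷ _ , _ , ()) , _)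

  τ≡2⇒every-vertex-avoided : CoverNumber H 2 → ∀ v → ∃ λ g → g ∈ H × v ∉ verts g
  τ≡2⇒every-vertex-avoided (_ , minimal) v with all-or-some H (λ {g} _ → toSum (v ∈? verts g))
  ... | inj₁ covers = ⊥-elim (<-irrefl refl (minimal (v ∷ []) (λ _ g∈ → v , here refl , covers g∈)))
  ... | inj₂ avoider = avoider

  avoided⇒noCoveringVertex : (∀ v → ∃ λ g → g ∈ H × v ∉ verts g) → NoCoveringVertex (_∈ H)
  avoided⇒noCoveringVertex avoided =
    (λ a → map₂ (map₂ λ a∉ → λ { refl → a∉ (here refl) }) (avoided (inj₁ a))) ,
    (λ b → map₂ (map₂ λ b∉ → λ { refl → b∉ (there (here refl)) }) (avoided (inj₂ (inj₁ b)))) ,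
    (λ c → map₂ (map₂ λ c∉ → λ { refl → c∉ (there (there (here refl))) }) (avoided (inj₂ (inj₂ c))))

  allShareTwo⇒homeBase : MatchingNumber H 1 → (∀ v → ∃ λ g → g ∈ H × v ∉ verts g) →
    ∀ R → AllShareTwo (_∈ H) R → IsHomeBase H
  allShareTwo⇒homeBase ν≡1 avoided R allShareTwo =
    [] , R ∷ [] , (distinct , [] , ν≡1) , saturating ,
    λ _ e∈ → inj₂ (R , here refl , shareTwo⇒containsTwo (allShareTwo e∈))
    where
      distinct : Unique (verts R)
      distinct = ((λ ()) ∷ (λ ()) ∷ []) ∷ ((λ ()) ∷ []) ∷ [] ∷ []

      saturating : ∀ i → SaturatingMatching H [] (R ∷ []) i
      saturating i with avoided (vertexAt i R)
      ... | g , g∈ , Rᵢ∉g =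
        (λ _ → vertexAt i g) , (λ { {zero} {zero} _ → refl }) ,
        λ { zero → vertexAt-inClass i g , outside , (g , g∈ , vertexAt-∈ i g , shareTwo⇒containsTwo (allShareTwo g∈)) }
        where
          outside : vertexAt i g ∉ verts R
          outside gᵢ∈R = Rᵢ∉g (subst (_∈ verts g) (vertexAt-∈⇒≡ i gᵢ∈R) (vertexAt-∈ i g))

  truncatedFano⇒homeBase : MatchingNumber H 1 → TruncatedFano (_∈ H) → IsHomeBase H
  truncatedFano⇒homeBase ν≡1 F =
    F′ ∷ [] , [] , (distinct , isTruncMultiFano ∷ [] , ν≡1) ,
    (λ _ → (λ ()) , (λ { {()} }) , λ ()) ,
    λ _ e∈ → inj₁ (F′ , here refl , inBlock (only e∈))
    where
      open TruncatedFano F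
      F′ : Block
      F′ = block a x b y c z

      distinct : Unique (blockVerts F′)
      distinct =
        (a≢x ∘ inj₁-injective ∷ (λ ()) ∷ (λ ()) ∷ (λ ()) ∷ (λ ()) ∷ []) ∷
        ((λ ()) ∷ (λ ()) ∷ (λ ()) ∷ (λ ()) ∷ []) ∷
        (b≢y ∘ inj₁-injective ∘ inj₂-injective ∷ (λ ()) ∷ (λ ()) ∷ []) ∷
        ((λ ()) ∷ (λ ()) ∷ []) ∷
        (c≢z ∘ inj₂-injective ∘ inj₂-injective ∷ []) ∷
        [] ∷ []

      isTruncMultiFano : IsTruncMultiFano H F′
      isTruncMultiFano = (λ _ e∈ _ → only e∈) , abc∈ , ayz∈ , xbz∈ , xyc∈

      inBlock : ∀ {e} → e ≡ (a , b , c) ⊎ e ≡ (a , y , z) ⊎ e ≡ (x , b , z) ⊎ e ≡ (x , y , c) →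
        EdgeIn (blockVerts F′) e
      inBlock (inj₁ refl) =
        here refl ∷ there (there (here refl)) ∷ there (there (there (there (here refl)))) ∷ []
      inBlock (inj₂ (inj₁ refl)) =
        here refl ∷ there (there (there (here refl))) ∷ there (there (there (there (there (here refl))))) ∷ []
      inBlock (inj₂ (inj₂ (inj₁ refl))) =
        there (here refl) ∷ there (there (here refl)) ∷ there (there (there (there (there (here refl))))) ∷ []
      inBlock (inj₂ (inj₂ (inj₂ refl))) =
        there (here refl) ∷ there (there (there (here refl))) ∷ there (there (there (there (here refl)))) ∷ []

proposition7p1 : {n₁ n₂ n₃ : ℕ} (H : List (Edge n₁ n₂ n₃)) →
    MatchingNumber H 1 → CoverNumber H 2 → IsHomeBase H
proposition7p1 H ν≡1 τ≡2 =
  [ (λ (R , allShareTwo) → allShareTwo⇒homeBase ν≡1 avoided R allShareTwo)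
  , truncatedFano⇒homeBase ν≡1
  ]′ classification
  where
    avoided : ∀ v → ∃ λ g → g ∈ H × v ∉ verts g
    avoided = τ≡2⇒every-vertex-avoided τ≡2

    classification : Classification (_∈ H)
    classification =
      classify _≟_ _≟_ _≟_ H (ν≡1⇒intersecting ν≡1) (avoided⇒noCoveringVertex avoided)
        (proj₂ (ν≡1⇒nonempty ν≡1))
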